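{- Let $a,b\geq 3$ and $m\geq 1$ be integers with $m\leq \min\{a,b\}-2$. Then $K_{a,b}^{1/m}$ is not locatable.
   Context: $K_{a,b}$ is the complete bipartite graph with parts of sizes $a$ and $b$. For a graph $G$ and positive integer $m$, $G^{1/m}$ denotes the graph obtained from $G$ by replacing each edge by a path of length $m$ through $m-1$ new vertices. The Robber Locating game on a finite connected graph: a robber occupies an (initially unknown) vertex. In each round the robber first either stays or moves to an adjacent vertex, and then the cop probes any vertex $v$ and is told the current distance from $v$ to the robber; there is no further restriction on the robber's moves. The cop wins if at some point she can determine the robber's current vertex uniquely. The robber is omniscient. A graph is locatable if the cop has a strategy guaranteed to win within a bounded number of rounds, equivalently one that wins against every robber behaviour. -}

module Defs where

open import Data.Nat using (ℕ; zero; suc; _≤_; _<_; _∸_)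
open import Data.Fin using (Fin; toℕ)
open import Data.List using (List; []; _∷_)
open import Data.Product using (Σ; ∃; _×_; _,_)
open import Data.Sum using (_⊎_)
open import Relation.Binary.PropositionalEquality using (_≡_)

record Graph : Set₁ where
  field
    V   : Set
    Adj : V → V → Set

module _ (G : Graph) where
  open Graph G

  data Walk : V → V → ℕ → Set where
    here : ∀ {u} → Walk u u 0
    step : ∀ {u w v k} → Adj u w → Walk w v k → Walk u v (suc k)

  Dist : V → V → ℕ → Set
  Dist u v d = Walk u v d × (∀ k → Walk u v k → d ≤ k)

  -- A robber trajectory: r t is the robber's position in round t (after
  -- his move in round t); between rounds he stays or moves to a neighbour.
  IsRobberWalk : (ℕ → V) → Set
  IsRobberWalk r = ∀ t → r (suc t) ≡ r t ⊎ Adj (r t) (r (suc t))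

  -- A (deterministic, adaptive) cop strategy: the vertex to probe, as a
  -- function of the answers received so far (newest answer first).
  CopStrategy : Set
  CopStrategy = List ℕ → V

  data Run (σ : CopStrategy) (r : ℕ → V) : ℕ → List ℕ → Set where
    start : Run σ r 0 []
    round : ∀ {t as d} → Run σ r t as → Dist (σ as) (r t) d →
            Run σ r (suc t) (d ∷ as)

  -- After round t (i.e. after t+1 probes) the cop knows the robber's
  -- current vertex: every robber trajectory producing the same answers is
  -- at the same vertex in round t.
  Located : CopStrategy → (ℕ → V) → ℕ → Set
  Located σ r t =
    ∀ as → Run σ r (suc t) as →
    ∀ r′ → IsRobberWalk r′ → Run σ r′ (suc t) as → r′ t ≡ r t

  Locatable : Set
  Locatable = Σ CopStrategy λ σ → Σ ℕ λ N →
    ∀ r → IsRobberWalk r → Σ ℕ λ t → t < N × Located σ r t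

-- K_{a,b}^{1/m}: left branch vertices left i (i < a), right branch vertices
-- right j (j < b), and for each pair (i , j) the internal vertices
-- mid i j k (k < m - 1) of the path of length m from left i to right j,
-- numbered from the left end.

data SubKV (a b m : ℕ) : Set where
  left  : Fin a → SubKV a b m
  right : Fin b → SubKV a b m
  mid   : Fin a → Fin b → Fin (m ∸ 1) → SubKV a b m

data SubKE (a b m : ℕ) : SubKV a b m → SubKV a b m → Set where
  lr : ∀ {i j} → m ≡ 1 → SubKE a b m (left i) (right j)
  lm : ∀ {i j k} → toℕ k ≡ 0 → SubKE a b m (left i) (mid i j k)
  mm : ∀ {i j k k′} → toℕ k′ ≡ suc (toℕ k) →
       SubKE a b m (mid i j k) (mid i j k′)
  mr : ∀ {i j k} → suc (toℕ k) ≡ m ∸ 1 → SubKE a b m (mid i j k) (right j)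

SubK : ℕ → ℕ → ℕ → Graph
SubK a b m = record
  { V   = SubKV a b m
  ; Adj = λ u v → SubKE a b m u v ⊎ SubKE a b m v u
  }

module Submission where

-- The robber keeps the cop unable to rule out a whole family of vertices:
-- the right (or left) branch vertices whose index avoids an excluded list,
-- or the internal vertices at one position on the paths from a fixed branch
-- vertex whose other end avoids such a list.  A probe at v sees all members
-- at the same distance when v's own index is excluded, since swapping two
-- free indices is an automorphism fixing v.  Otherwise the robber runs along
-- the paths to the other side, excluding at most one index per round; so the
-- lists stay of length ≤ m, and a, b ≥ m + 2 always leave two candidates.

open import Defs
open import Data.Nat using (ℕ; zero; suc; _≤_; _<_; _+_; _∸_; _≤?_; z≤n; s≤s)
open import Data.Nat.Properties
  using ( anyUpTo?; ≮⇒≥; <⇒≱; <⇒≤; ≤-refl; ≤-reflexive; ≤-trans; ≤-pred; n≤1+n; m<n⇒m<1+n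
        ; m≤n⇒m<n∨m≡n; <-cmp; m≤m+n; m∸n≤m; +-suc; +-comm; +-monoˡ-≤; +-monoʳ-≤
        ; m+[n∸m]≡n; m<n⇒0<n∸m; ≤∧≢⇒<; ∸-monoʳ-<; suc-injective; module ≤-Reasoning)
import Data.Nat.Properties as ℕ
open import Data.Nat.Induction using (<-wellFounded)
open import Induction.WellFounded using (Acc; acc)
open import Data.Fin using (Fin; toℕ; fromℕ<)
open import Data.Fin.Properties using (_≟_; any?; ¬∀⟶∃¬; pigeonhole; <⇒≢; toℕ<n; toℕ-fromℕ<)
open import Data.Fin.Permutation.Components using (transpose; transpose-inverse)
open import Data.List using (List; []; _∷_; _++_; length; lookup)
open import Data.List.Properties using (length-++)
open import Data.List.Membership.Propositional using (_∈_; _∉_)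
open import Data.List.Membership.Propositional.Properties using (∈-++⁺ˡ; ∈-++⁺ʳ)
open import Data.List.Relation.Unary.Any using (here; there; index; satisfied)
import Data.List.Relation.Unary.Any as Any
open import Data.List.Relation.Unary.Any.Properties using (lookup-index)
open import Data.List.Relation.Unary.All using (All; []; _∷_; all?; tabulate)
open import Data.List.Relation.Unary.All.Properties using (¬All⇒Any¬)
open import Data.Product using (Σ; _×_; _,_; proj₁; proj₂)
open import Data.Sum using (_⊎_; inj₁; inj₂)
open import Function using (id; _∘_)
open import Relation.Binary using (DecidableEquality; tri<; tri≈; tri>)
open import Relation.Binary.PropositionalEquality
  using (_≡_; _≢_; refl; sym; trans; cong; cong₂; subst; subst₂; module ≡-Reasoning)
open import Relation.Nullary using (¬_; Dec; yes; no; contradiction)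
open import Relation.Nullary.Decidable using (map′; _×-dec_; _⊎-dec_)

-- Least number principle for decidable predicates on ℕ; it turns the
-- existence of a walk into the existence of a shortest one.
least : {P : ℕ → Set} → (∀ n → Dec (P n)) → ∀ {n} → P n →
        Σ ℕ λ d → P d × (∀ k → P k → d ≤ k)
least {P} P? {n} = go n (<-wellFounded n)
  where
    go : ∀ n → Acc _<_ n → P n → Σ ℕ λ d → P d × (∀ k → P k → d ≤ k)
    go n (acc smaller) pn with anyUpTo? P? n
    ... | yes (k , k<n , pk) = go k (smaller k<n) pk
    ... | no none            = n , pn , λ k pk → ≮⇒≥ λ k<n → none (k , k<n , pk)

_∈?_ : ∀ {n} (j : Fin n) (X : List (Fin n)) → Dec (j ∈ X)
j ∈? X = Any.any? (j ≟_) X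

missing : ∀ {n} (X : List (Fin n)) → length X < n → Σ (Fin n) (_∉ X)
missing {n} X short = ¬∀⟶∃¬ n (_∈ X) (_∈? X) covers-all
  where
    open ≡-Reasoning
    covers-all : ¬ (∀ j → j ∈ X)
    covers-all all∈ with pigeonhole short (λ j → index (all∈ j))
    ... | i , j , i<j , same-index = <⇒≢ i<j (begin
      i                          ≡⟨ lookup-index (all∈ i) ⟩
      lookup X (index (all∈ i))  ≡⟨ cong (lookup X) same-index ⟩
      lookup X (index (all∈ j))  ≡⟨ sym (lookup-index (all∈ j)) ⟩
      j                          ∎)

twoMissing : ∀ {n} (X : List (Fin n)) → 2 + length X ≤ n →
             Σ (Fin n) λ j → Σ (Fin n) λ j′ → j ∉ X × j′ ∉ X × j ≢ j′
twoMissing X room with missing X (≤-trans (n≤1+n _) room)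
... | j , j∉X with missing (j ∷ X) room
... | j′ , j′∉jX = j , j′ , j∉X , j′∉jX ∘ there , λ j≡j′ → j′∉jX (here (sym j≡j′))

transpose-source : ∀ {n} (i j : Fin n) → transpose i j i ≡ j
transpose-source i j with i ≟ i
... | yes _  = refl
... | no i≢i = contradiction refl i≢i

transpose-fixes : ∀ {n} {i j k : Fin n} → k ≢ i → k ≢ j → transpose i j k ≡ k
transpose-fixes {i = i} {j} {k} k≢i k≢j with k ≟ i
... | yes k≡i = contradiction k≡i k≢i
... | no _ with k ≟ j
...   | yes k≡j = contradiction k≡j k≢j
...   | no _    = refl

module WalkAlgebra (G : Graph) where
  open Graph G

  _++ʷ_ : ∀ {u v w k l} → Walk G u v k → Walk G v w l → Walk G u w (k + l)
  here       ++ʷ q = q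
  step e p   ++ʷ q = step e (p ++ʷ q)

  module _ (symmetric : ∀ {x y} → Adj x y → Adj y x) where

    reverseʷ : ∀ {u v k} → Walk G u v k → Walk G v u k
    reverseʷ here       = here
    reverseʷ (step e p) = subst (Walk G _ _) (+-comm _ 1) (reverseʷ p ++ʷ step (symmetric e) here)

module Distances (G : Graph)
  (_≟V_ : DecidableEquality (Graph.V G))
  (adj? : ∀ u v → Dec (Graph.Adj G u v))
  (search : ∀ {P : Graph.V G → Set} → (∀ x → Dec (P x)) → Dec (Σ (Graph.V G) P))
  where

  walk? : ∀ k u v → Dec (Walk G u v k)
  walk? zero    u v = map′ (λ { refl → here }) (λ { here → refl }) (u ≟V v)
  walk? (suc k) u v =
    map′ (λ (w , e , p) → step e p) (λ { (step e p) → _ , e , p })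
         (search λ w → adj? u w ×-dec walk? k w v)

  distance : ∀ {u v k} → Walk G u v k → Σ ℕ (Dist G u v)
  distance {u} {v} = least (λ k → walk? k u v)

-- The evasion principle.  A robber strategy is described by configurations c,
-- each standing for a set  Mem c  of vertices the cop cannot tell apart.
module Evasion (G : Graph) where
  open Graph G

  record Escape {Conf : Set} (Mem : Conf → V → Set) (Viable : Conf → Set)
                (c : Conf) (v : V) : Set where
    field
      target      : Conf
      viable      : Viable target
      reachable   : ∀ {y} → Mem target y → Σ V λ x → Mem c x × (y ≡ x ⊎ Adj x y)
      equidistant : ∀ {y y′ d} → Mem target y → Mem target y′ → Dist G v y d → Dist G v y′ d

  record EvasionSystem : Set₁ where
    field
      Conf           : Set
      Mem            : Conf → V → Set
      Viable         : Conf → Set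
      initial        : Conf
      initial-viable : Viable initial
      two-members    : ∀ c → Viable c → Σ V λ y → Σ V λ y′ → Mem c y × Mem c y′ × y ≢ y′
      escape         : ∀ c → Viable c → ∀ v → Escape Mem Viable c v

  divert : (ℕ → V) → ℕ → V → ℕ → V
  divert r t y s with s ≤? t
  ... | yes _ = r s
  ... | no _  = y

  divert-before : ∀ r {t} y {s} → s ≤ t → divert r t y s ≡ r s
  divert-before r {t} y {s} s≤t with s ≤? t
  ... | yes _   = refl
  ... | no s≰t  = contradiction s≤t s≰t

  divert-after : ∀ r {t} y {s} → t < s → divert r t y s ≡ y
  divert-after r {t} y {s} t<s with s ≤? t
  ... | yes s≤t = contradiction s≤t (<⇒≱ t<s)
  ... | no _    = refl

  divert-walk : ∀ {r t x y} → IsRobberWalk G r → r t ≡ x → (y ≡ x ⊎ Adj x y) →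
                IsRobberWalk G (divert r t y)
  divert-walk {r} {t} {y = y} walk rt≡x move s with <-cmp s t
  ... | tri< s<t _ _
    rewrite divert-before r y (<⇒≤ s<t) | divert-before r y s<t = walk s
  ... | tri≈ _ refl _
    rewrite divert-before r y (≤-refl {s}) | divert-after r y (≤-refl {suc s}) | rt≡x = move
  ... | tri> _ _ t<s
    rewrite divert-after r y t<s | divert-after r y (m<n⇒m<1+n t<s) = inj₁ refl

  run-agree : ∀ {σ r r′ n as} → Run G σ r n as → (∀ {s} → s < n → r s ≡ r′ s) →
              Run G σ r′ n as
  run-agree start agree = start
  run-agree {σ} (round {as = as} {d = d} run dist) agree =
    round (run-agree run (agree ∘ m<n⇒m<1+n))
          (subst (λ z → Dist G (σ as) z d) (agree ≤-refl) dist)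

  Consistent : CopStrategy G → ℕ → List ℕ → V → Set
  Consistent σ t as y = Σ (ℕ → V) λ r → IsRobberWalk G r × Run G σ r (suc t) as × r t ≡ y

  extend : ∀ {σ t as d x y} → Consistent σ t as x → (y ≡ x ⊎ Adj x y) →
           Dist G (σ as) y d → Consistent σ (suc t) (d ∷ as) y
  extend {σ} {t} {as} {d} {y = y} (r , walk , run , rt≡x) move dist =
    divert r t y ,
    divert-walk walk rt≡x move ,
    round (run-agree run λ { (s≤s s≤t) → sym (divert-before r y s≤t) })
          (subst (λ z → Dist G (σ as) z d) (sym (divert-after r {t} y ≤-refl)) dist) ,
    divert-after r {t} y ≤-refl

  module _ (distanceBetween : ∀ u v → Σ ℕ (Dist G u v)) (E : EvasionSystem) where
    open EvasionSystem E
    open Escape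

    answer : ∀ {c v} (e : Escape Mem Viable c v) →
             Σ ℕ λ d → ∀ {y} → Mem (target e) y → Dist G v y d
    answer {v = v} e with two-members (target e) (viable e)
    ... | y , _ , my , _ =
      proj₁ (distanceBetween v y) , λ my′ → equidistant e my my′ (proj₂ (distanceBetween v y))

    record Stage (σ : CopStrategy G) (t : ℕ) : Set where
      field
        answers           : List ℕ
        candidates        : Conf
        candidates-viable : Viable candidates
        consistent        : ∀ {y} → Mem candidates y → Consistent σ t answers y
    open Stage

    stage : ∀ σ t → Stage σ t
    stage σ zero = record
      { answers           = proj₁ (answer e) ∷ []
      ; candidates        = target e
      ; candidates-viable = viable e
      ; consistent        = λ {y} my →
          (λ _ → y) , (λ _ → inj₁ refl) , round start (proj₂ (answer e) my) , refl
      }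
      where e = escape initial initial-viable (σ [])
    stage σ (suc t) = record
      { answers           = proj₁ (answer e) ∷ answers S
      ; candidates        = target e
      ; candidates-viable = viable e
      ; consistent        = λ my →
          let (x , mx , move) = reachable e my
          in  extend (consistent S mx) move (proj₂ (answer e) my)
      }
      where
        S = stage σ t
        e = escape (candidates S) (candidates-viable S) (σ (answers S))

    run-prefix : ∀ {σ r t} n → t ≤ n → Run G σ r (suc n) (answers (stage σ n)) →
                 Run G σ r (suc t) (answers (stage σ t))
    run-prefix zero    z≤n   run = run
    run-prefix (suc n) t≤1+n run@(round earlier _) with m≤n⇒m<n∨m≡n t≤1+n
    ... | inj₁ t<1+n = run-prefix n (≤-pred t<1+n) earlier
    ... | inj₂ refl  = run

    not-located : ∀ {σ t r} → Run G σ r (suc t) (answers (stage σ t)) → ¬ Located G σ r t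
    not-located {σ} {t} {r} run located
      with two-members (candidates (stage σ t)) (candidates-viable (stage σ t))
    ... | y₁ , y₂ , m₁ , m₂ , y₁≢y₂
      with consistent (stage σ t) m₁ | consistent (stage σ t) m₂
    ... | r₁ , w₁ , run₁ , r₁t≡y₁ | r₂ , w₂ , run₂ , r₂t≡y₂ = y₁≢y₂ (begin
      y₁    ≡⟨ sym r₁t≡y₁ ⟩
      r₁ t  ≡⟨ located _ run r₁ w₁ run₁ ⟩
      r t   ≡⟨ sym (located _ run r₂ w₂ run₂) ⟩
      r₂ t  ≡⟨ r₂t≡y₂ ⟩
      y₂    ∎)
      where open ≡-Reasoning

    -- Against any cop strategy and bound N, a robber consistent with stage N
    -- is never located before round N.
    evasion⇒¬locatable : ¬ Locatable G
    evasion⇒¬locatable (σ , N , wins)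
      with two-members (candidates (stage σ N)) (candidates-viable (stage σ N))
    ... | _ , _ , my , _ with consistent (stage σ N) my
    ... | r , walk , run , _ with wins r walk
    ... | t , t<N , located = not-located (run-prefix N (<⇒≤ t<N) run) located

module SubdividedBiclique (a b m : ℕ) (m≥1 : 1 ≤ m) (a-large : m + 2 ≤ a) (b-large : m + 2 ≤ b)
  where

  G : Graph
  G = SubK a b m

  open Graph G
  open WalkAlgebra G
  open Evasion G

  symmetric : ∀ {x y} → Adj x y → Adj y x
  symmetric (inj₁ e) = inj₂ e
  symmetric (inj₂ e) = inj₁ e

  _≟V_ : DecidableEquality V
  left i    ≟V left i′     = map′ (cong left) (λ { refl → refl }) (i ≟ i′)
  right j   ≟V right j′    = map′ (cong right) (λ { refl → refl }) (j ≟ j′)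
  mid i j k ≟V mid i′ j′ k′ =
    map′ (λ { (refl , refl , refl) → refl }) (λ { refl → refl , refl , refl })
         (i ≟ i′ ×-dec j ≟ j′ ×-dec k ≟ k′)
  left _    ≟V right _     = no λ ()
  left _    ≟V mid _ _ _   = no λ ()
  right _   ≟V left _      = no λ ()
  right _   ≟V mid _ _ _   = no λ ()
  mid _ _ _ ≟V left _      = no λ ()
  mid _ _ _ ≟V right _     = no λ ()

  edge? : ∀ u v → Dec (SubKE a b m u v)
  edge? (left i) (right j) = map′ lr (λ { (lr e) → e }) (m ℕ.≟ 1)
  edge? (left i) (mid i′ j k) =
    map′ (λ { (refl , e) → lm e }) (λ { (lm e) → refl , e }) (i ≟ i′ ×-dec toℕ k ℕ.≟ 0)
  edge? (mid i j k) (mid i′ j′ k′) =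
    map′ (λ { (refl , refl , e) → mm e }) (λ { (mm e) → refl , refl , e })
         (i ≟ i′ ×-dec j ≟ j′ ×-dec toℕ k′ ℕ.≟ suc (toℕ k))
  edge? (mid i j k) (right j′) =
    map′ (λ { (refl , e) → mr e }) (λ { (mr e) → refl , e }) (j ≟ j′ ×-dec suc (toℕ k) ℕ.≟ m ∸ 1)
  edge? (left _)    (left _)    = no λ ()
  edge? (right _)   (left _)    = no λ ()
  edge? (right _)   (right _)   = no λ ()
  edge? (right _)   (mid _ _ _) = no λ ()
  edge? (mid _ _ _) (left _)    = no λ ()

  adj? : ∀ u v → Dec (Adj u v)
  adj? u v = edge? u v ⊎-dec edge? v u

  search : ∀ {P : V → Set} → (∀ x → Dec (P x)) → Dec (Σ V P)
  search {P} P? with any? (P? ∘ left) | any? (P? ∘ right) | any? (λ i → any? λ j → any? λ k → P? (mid i j k))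
  ... | yes (i , p) | _           | _                   = yes (left i , p)
  ... | no _        | yes (j , p) | _                   = yes (right j , p)
  ... | no _        | no _        | yes (i , j , k , p) = yes (mid i j k , p)
  ... | no ¬l       | no ¬r       | no ¬m               =
    no λ { (left i , p) → ¬l (i , p) ; (right j , p) → ¬r (j , p) ; (mid i j k , p) → ¬m (i , j , k , p) }

  open Distances G _≟V_ adj? search

  data PathShape : Set where
    direct     : m ≡ 1 → PathShape
    subdivided : (first last : Fin (m ∸ 1)) → toℕ first ≡ 0 → suc (toℕ last) ≡ m ∸ 1 → PathShape

  pathShape : PathShape
  pathShape with m ℕ.≟ 1
  ... | yes m≡1 = direct m≡1
  ... | no  m≢1 = subdivided (fromℕ< 0<m∸1) (fromℕ< last<m∸1) (toℕ-fromℕ< 0<m∸1)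
                    (trans (cong suc (toℕ-fromℕ< last<m∸1)) (m+[n∸m]≡n 0<m∸1))
    where
      0<m∸1 : 0 < m ∸ 1
      0<m∸1 = m<n⇒0<n∸m (≤∧≢⇒< m≥1 (m≢1 ∘ sym))
      last<m∸1 : m ∸ 1 ∸ 1 < m ∸ 1
      last<m∸1 = ∸-monoʳ-< {m ∸ 1} {1} {0} (s≤s z≤n) 0<m∸1

  data Successor (k : Fin (m ∸ 1)) : Set where
    last-mid : suc (toℕ k) ≡ m ∸ 1 → Successor k
    next-mid : (k′ : Fin (m ∸ 1)) → toℕ k′ ≡ suc (toℕ k) → Successor k

  successor : ∀ k → Successor k
  successor k with suc (toℕ k) ℕ.<? m ∸ 1
  ... | yes k+1<m∸1 = next-mid (fromℕ< k+1<m∸1) (toℕ-fromℕ< k+1<m∸1)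
  ... | no  k+1≮m∸1 = last-mid (ℕ.≤-antisym (toℕ<n k) (≮⇒≥ k+1≮m∸1))

  data Predecessor (k : Fin (m ∸ 1)) : Set where
    first-mid : toℕ k ≡ 0 → Predecessor k
    prev-mid  : (k′ : Fin (m ∸ 1)) → toℕ k ≡ suc (toℕ k′) → Predecessor k

  predecessor : ∀ k → Predecessor k
  predecessor k with toℕ k in k≡
  ... | zero  = first-mid k≡
  ... | suc p = prev-mid (fromℕ< p<m∸1) (trans k≡ (cong suc (sym (toℕ-fromℕ< p<m∸1))))
    where
      p<m∸1 : p < m ∸ 1
      p<m∸1 = ℕ.<-trans (ℕ.n<1+n p) (subst (_< m ∸ 1) k≡ (toℕ<n k))

  midToLeft : ∀ {i j} p (k : Fin (m ∸ 1)) → toℕ k ≡ p → Walk G (mid i j k) (left i) (suc p)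
  midToLeft zero    k k≡0 = step (inj₂ (lm k≡0)) here
  midToLeft (suc p) k k≡1+p with predecessor k
  ... | first-mid k≡0    = contradiction (trans (sym k≡0) k≡1+p) λ ()
  ... | prev-mid k′ k≡1+k′ =
    step (inj₂ (mm k≡1+k′)) (midToLeft p k′ (suc-injective (trans (sym k≡1+k′) k≡1+p)))

  rightToLeft : ∀ i j → Σ ℕ (Walk G (right j) (left i))
  rightToLeft i j with pathShape
  ... | direct m≡1 = 1 , step (inj₂ (lr m≡1)) here
  ... | subdivided _ last _ last≡ = _ , step (inj₂ (mr last≡)) (midToLeft _ last refl)

  positive : ∀ {n} → m + 2 ≤ n → 0 < n
  positive m+2≤n = ≤-trans (s≤s z≤n) (≤-trans (ℕ.m≤n+m 2 m) m+2≤n)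

  i₀ : Fin a
  i₀ = fromℕ< (positive a-large)

  j₀ : Fin b
  j₀ = fromℕ< (positive b-large)

  toLeft₀ : ∀ u → Σ ℕ (Walk G u (left i₀))
  toLeft₀ (right j)   = rightToLeft i₀ j
  toLeft₀ (left i)    =
    _ , reverseʷ symmetric (proj₂ (rightToLeft i j₀)) ++ʷ proj₂ (rightToLeft i₀ j₀)
  toLeft₀ (mid i j k) = _ , midToLeft _ k refl ++ʷ proj₂ (toLeft₀ (left i))

  distanceBetween : ∀ u v → Σ ℕ (Dist G u v)
  distanceBetween u v = distance (proj₂ (toLeft₀ u) ++ʷ reverseʷ symmetric (proj₂ (toLeft₀ v)))

  relabel : (Fin a → Fin a) → (Fin b → Fin b) → V → V
  relabel f g (left i)    = left (f i)
  relabel f g (right j)   = right (g j)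
  relabel f g (mid i j k) = mid (f i) (g j) k

  relabel-edge : ∀ f g {x y} → SubKE a b m x y → SubKE a b m (relabel f g x) (relabel f g y)
  relabel-edge f g (lr e) = lr e
  relabel-edge f g (lm e) = lm e
  relabel-edge f g (mm e) = mm e
  relabel-edge f g (mr e) = mr e

  relabel-walk : ∀ f g {x y k} → Walk G x y k → Walk G (relabel f g x) (relabel f g y) k
  relabel-walk f g here               = here
  relabel-walk f g (step (inj₁ e) p) = step (inj₁ (relabel-edge f g e)) (relabel-walk f g p)
  relabel-walk f g (step (inj₂ e) p) = step (inj₂ (relabel-edge f g e)) (relabel-walk f g p)

  module _ {f f′ : Fin a → Fin a} {g g′ : Fin b → Fin b}
           (f′∘f : ∀ i → f′ (f i) ≡ i) (g′∘g : ∀ j → g′ (g j) ≡ j) where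

    relabel-inverse : ∀ u → relabel f′ g′ (relabel f g u) ≡ u
    relabel-inverse (left i)    = cong left (f′∘f i)
    relabel-inverse (right j)   = cong right (g′∘g j)
    relabel-inverse (mid i j k) = cong₂ (λ i′ j′ → mid i′ j′ k) (f′∘f i) (g′∘g j)

    relabel-dist : ∀ {u w d} → Dist G u w d → Dist G (relabel f g u) (relabel f g w) d
    relabel-dist {u} {w} (walk , shortest) =
      relabel-walk f g walk ,
      λ k walk′ → shortest k (subst₂ (λ x y → Walk G x y k) (relabel-inverse u) (relabel-inverse w)
                                       (relabel-walk f′ g′ walk′))

  rightIdx : V → List (Fin b)
  rightIdx (left _)    = []
  rightIdx (right j)   = j ∷ []
  rightIdx (mid _ j _) = j ∷ []

  leftIdx : V → List (Fin a)
  leftIdx (left i)    = i ∷ []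
  leftIdx (right _)   = []
  leftIdx (mid i _ _) = i ∷ []

  rightIdx-short : ∀ v → length (rightIdx v) ≤ 1
  rightIdx-short (left _)    = z≤n
  rightIdx-short (right _)   = ≤-refl
  rightIdx-short (mid _ _ _) = ≤-refl

  leftIdx-short : ∀ v → length (leftIdx v) ≤ 1
  leftIdx-short (left _)    = ≤-refl
  leftIdx-short (right _)   = z≤n
  leftIdx-short (mid _ _ _) = ≤-refl

  -- Swapping two right indices outside X fixes every probe whose right
  -- index lies in X, so such a probe sees y and the swapped y at the same
  -- distance.
  swapRight : Fin b → Fin b → V → V
  swapRight j j′ = relabel id (transpose j j′)

  swapLeft : Fin a → Fin a → V → V
  swapLeft i i′ = relabel (transpose i i′) id

  avoid : ∀ {n} {X : List (Fin n)} {j k} → j ∉ X → k ∈ X → k ≢ j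
  avoid j∉X k∈X refl = j∉X k∈X

  swapRight-fixes : ∀ {X j j′} v → All (_∈ X) (rightIdx v) → j ∉ X → j′ ∉ X → swapRight j j′ v ≡ v
  swapRight-fixes (left _)    _             _   _    = refl
  swapRight-fixes (right _)   (idx∈X ∷ []) j∉X j′∉X =
    cong right (transpose-fixes (avoid j∉X idx∈X) (avoid j′∉X idx∈X))
  swapRight-fixes (mid i _ k) (idx∈X ∷ []) j∉X j′∉X =
    cong (λ j″ → mid i j″ k) (transpose-fixes (avoid j∉X idx∈X) (avoid j′∉X idx∈X))

  swapLeft-fixes : ∀ {Y i i′} v → All (_∈ Y) (leftIdx v) → i ∉ Y → i′ ∉ Y → swapLeft i i′ v ≡ v
  swapLeft-fixes (right _)   _             _   _    = refl
  swapLeft-fixes (left _)    (idx∈Y ∷ []) i∉Y i′∉Y =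
    cong left (transpose-fixes (avoid i∉Y idx∈Y) (avoid i′∉Y idx∈Y))
  swapLeft-fixes (mid _ j k) (idx∈Y ∷ []) i∉Y i′∉Y =
    cong (λ i″ → mid i″ j k) (transpose-fixes (avoid i∉Y idx∈Y) (avoid i′∉Y idx∈Y))

  swapRight-dist : ∀ {X j j′ v y d} → All (_∈ X) (rightIdx v) → j ∉ X → j′ ∉ X →
                   Dist G v y d → Dist G v (swapRight j j′ y) d
  swapRight-dist {j = j} {j′} {v} fixed j∉X j′∉X dist =
    subst (λ x → Dist G x _ _) (swapRight-fixes v fixed j∉X j′∉X)
          (relabel-dist {g′ = transpose j′ j} (λ _ → refl) (λ _ → transpose-inverse j′ j) dist)

  swapLeft-dist : ∀ {Y i i′ v y d} → All (_∈ Y) (leftIdx v) → i ∉ Y → i′ ∉ Y →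
                  Dist G v y d → Dist G v (swapLeft i i′ y) d
  swapLeft-dist {i = i} {i′} {v} fixed i∉Y i′∉Y dist =
    subst (λ x → Dist G x _ _) (swapLeft-fixes v fixed i∉Y i′∉Y)
          (relabel-dist {f′ = transpose i′ i} (λ _ → transpose-inverse i′ i) (λ _ → refl) dist)

  -- Robber configurations; the robber is known to be
  --   onRight X        at some right branch vertex  right j,    j ∉ X,
  --   onLeft Y         at some left branch vertex   left i,     i ∉ Y,
  --   fromLeft i k X   at some internal vertex      mid i j k,  j ∉ X,
  --   fromRight j k Y  at some internal vertex      mid i j k,  i ∉ Y;
  -- on the paths he runs away from the fixed branch vertex, one step a round.
  data Conf : Set where
    onRight   : List (Fin b) → Conf
    onLeft    : List (Fin a) → Conf
    fromLeft  : Fin a → Fin (m ∸ 1) → List (Fin b) → Conf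
    fromRight : Fin b → Fin (m ∸ 1) → List (Fin a) → Conf

  Among : ∀ {n} → List (Fin n) → (Fin n → V) → V → Set
  Among X shape y = Σ _ λ j → j ∉ X × y ≡ shape j

  Mem : Conf → V → Set
  Mem (onRight X)       = Among X right
  Mem (onLeft Y)        = Among Y left
  Mem (fromLeft i k X)  = Among X λ j → mid i j k
  Mem (fromRight j k Y) = Among Y λ i → mid i j k

  -- The excluded list grows by at most one index per round spent on the
  -- paths, which bounds it by m everywhere.
  Viable : Conf → Set
  Viable (onRight X)       = length X ≤ m
  Viable (onLeft Y)        = length Y ≤ m
  Viable (fromLeft _ k X)  = length X ≤ suc (toℕ k)
  Viable (fromRight _ k Y) = length Y + suc (toℕ k) ≤ m

  room : ∀ {l n} → l ≤ m → m + 2 ≤ n → 2 + l ≤ n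
  room l≤m m+2≤n = ≤-trans (+-monoʳ-≤ 2 l≤m) (≤-trans (≤-reflexive (+-comm 2 m)) m+2≤n)

  two-among : ∀ {n} {X : List (Fin n)} {shape} → (∀ {j j′} → shape j ≡ shape j′ → j ≡ j′) →
              length X ≤ m → m + 2 ≤ n →
              Σ V λ y → Σ V λ y′ → Among X shape y × Among X shape y′ × y ≢ y′
  two-among {X = X} {shape} injective short large =
    let (j , j′ , j∉X , j′∉X , j≢j′) = twoMissing X (room short large)
    in  shape j , shape j′ , (j , j∉X , refl) , (j′ , j′∉X , refl) , j≢j′ ∘ injective

  two-members : ∀ c → Viable c → Σ V λ y → Σ V λ y′ → Mem c y × Mem c y′ × y ≢ y′
  two-members (onRight X)       viable = two-among (λ { refl → refl }) viable b-large
  two-members (onLeft Y)        viable = two-among (λ { refl → refl }) viable a-large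
  two-members (fromLeft i k X)  viable =
    two-among (λ { refl → refl }) (≤-trans viable (≤-trans (toℕ<n k) (m∸n≤m m 1))) b-large
  two-members (fromRight j k Y) viable =
    two-among (λ { refl → refl }) (≤-trans (m≤m+n _ _) viable) a-large

  Blind : Conf → V → Set
  Blind (onRight X)       v = All (_∈ X) (rightIdx v)
  Blind (onLeft Y)        v = All (_∈ Y) (leftIdx v)
  Blind (fromLeft _ _ X)  v = All (_∈ X) (rightIdx v)
  Blind (fromRight _ _ Y) v = All (_∈ Y) (leftIdx v)

  blind-equidistant : ∀ c {v y y′ d} → Blind c v → Mem c y → Mem c y′ → Dist G v y d → Dist G v y′ d
  blind-equidistant (onRight X) fixed (j , j∉X , refl) (j′ , j′∉X , refl) dist =
    subst (λ z → Dist G _ (right z) _) (transpose-source j j′) (swapRight-dist fixed j∉X j′∉X dist)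
  blind-equidistant (onLeft Y) fixed (i , i∉Y , refl) (i′ , i′∉Y , refl) dist =
    subst (λ z → Dist G _ (left z) _) (transpose-source i i′) (swapLeft-dist fixed i∉Y i′∉Y dist)
  blind-equidistant (fromLeft i k X) fixed (j , j∉X , refl) (j′ , j′∉X , refl) dist =
    subst (λ z → Dist G _ (mid i z k) _) (transpose-source j j′) (swapRight-dist fixed j∉X j′∉X dist)
  blind-equidistant (fromRight j k Y) fixed (i , i∉Y , refl) (i′ , i′∉Y , refl) dist =
    subst (λ z → Dist G _ (mid z j k) _) (transpose-source i i′) (swapLeft-dist fixed i∉Y i′∉Y dist)

  Reachable : Conf → V → Set
  Reachable c y = Σ V λ x → Mem c x × (y ≡ x ⊎ Adj x y)

  stay : ∀ {c y} → Mem c y → Reachable c y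
  stay my = _ , my , inj₁ refl

  escapeTo : ∀ {c v} c′ → Viable c′ → (∀ {y} → Mem c′ y → Reachable c y) → Blind c′ v →
             Escape Mem Viable c v
  escapeTo c′ viable reach blind = record
    { target = c′ ; viable = viable ; reachable = reach ; equidistant = blind-equidistant c′ blind }

  grow : ∀ {n} (xs : List (Fin n)) {ys l} → length xs ≤ 1 → length ys ≤ l →
         length (xs ++ ys) ≤ suc l
  grow xs {ys} short ys≤l =
    subst (_≤ _) (sym (length-++ xs)) (≤-trans (+-monoˡ-≤ (length ys) short) (s≤s ys≤l))

  1+[m∸1]≡m : suc (m ∸ 1) ≡ m
  1+[m∸1]≡m = m+[n∸m]≡n m≥1

  fleeLeft : ∀ {X v j} → j ∉ X → Escape Mem Viable (onRight X) v
  fleeLeft {v = v} {j} j∉X with pathShape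
  ... | direct m≡1 =
    escapeTo (onLeft (leftIdx v)) (≤-trans (leftIdx-short v) m≥1)
             (λ { (_ , _ , refl) → right j , (j , j∉X , refl) , inj₂ (inj₂ (lr m≡1)) })
             (tabulate id)
  ... | subdivided _ last _ last≡ =
    escapeTo (fromRight j last (leftIdx v)) entered
             (λ { (_ , _ , refl) → right j , (j , j∉X , refl) , inj₂ (inj₂ (mr last≡)) })
             (tabulate id)
    where
      entered : length (leftIdx v) + suc (toℕ last) ≤ m
      entered = ≤-trans (+-monoˡ-≤ _ (leftIdx-short v))
                        (≤-reflexive (trans (cong suc last≡) 1+[m∸1]≡m))

  fleeRight : ∀ {Y v i} → i ∉ Y → Escape Mem Viable (onLeft Y) v
  fleeRight {v = v} {i} i∉Y with pathShape
  ... | direct m≡1 =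
    escapeTo (onRight (rightIdx v)) (≤-trans (rightIdx-short v) m≥1)
             (λ { (_ , _ , refl) → left i , (i , i∉Y , refl) , inj₂ (inj₁ (lr m≡1)) })
             (tabulate id)
  ... | subdivided first _ first≡0 _ =
    escapeTo (fromLeft i first (rightIdx v))
             (subst (λ p → _ ≤ suc p) (sym first≡0) (rightIdx-short v))
             (λ { (_ , _ , refl) → left i , (i , i∉Y , refl) , inj₂ (inj₁ (lm first≡0)) })
             (tabulate id)

  atRight : ∀ {X} → Viable (onRight X) → ∀ v → Escape Mem Viable (onRight X) v
  atRight {X} viable v with all? (_∈? X) (rightIdx v)
  ... | yes covered  = escapeTo (onRight X) viable (stay {onRight X}) covered
  ... | no uncovered = fleeLeft (proj₂ (satisfied (¬All⇒Any¬ (_∈? X) (rightIdx v) uncovered)))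

  atLeft : ∀ {Y} → Viable (onLeft Y) → ∀ v → Escape Mem Viable (onLeft Y) v
  atLeft {Y} viable v with all? (_∈? Y) (leftIdx v)
  ... | yes covered  = escapeTo (onLeft Y) viable (stay {onLeft Y}) covered
  ... | no uncovered = fleeRight (proj₂ (satisfied (¬All⇒Any¬ (_∈? Y) (leftIdx v) uncovered)))

  runRight : ∀ {i k X} → Viable (fromLeft i k X) → ∀ v → Escape Mem Viable (fromLeft i k X) v
  runRight {i} {k} {X} viable v with successor k
  ... | next-mid k′ k′≡ =
    escapeTo (fromLeft i k′ (rightIdx v ++ X))
             (subst (λ p → _ ≤ suc p) (sym k′≡) (grow (rightIdx v) (rightIdx-short v) viable))
             (λ { (j , j∉ , refl) → mid i j k , (j , j∉ ∘ ∈-++⁺ʳ _ , refl) , inj₂ (inj₁ (mm k′≡)) })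
             (tabulate ∈-++⁺ˡ)
  ... | last-mid k≡ =
    escapeTo (onRight (rightIdx v ++ X))
             (≤-trans (grow (rightIdx v) (rightIdx-short v) viable)
                      (≤-reflexive (trans (cong suc k≡) 1+[m∸1]≡m)))
             (λ { (j , j∉ , refl) → mid i j k , (j , j∉ ∘ ∈-++⁺ʳ _ , refl) , inj₂ (inj₁ (mr k≡)) })
             (tabulate ∈-++⁺ˡ)

  runLeft : ∀ {j k Y} → Viable (fromRight j k Y) → ∀ v → Escape Mem Viable (fromRight j k Y) v
  runLeft {j} {k} {Y} viable v with predecessor k
  ... | prev-mid k′ k≡ =
    escapeTo (fromRight j k′ (leftIdx v ++ Y)) stepped
             (λ { (i , i∉ , refl) → mid i j k , (i , i∉ ∘ ∈-++⁺ʳ _ , refl) , inj₂ (inj₂ (mm k≡)) })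
             (tabulate ∈-++⁺ˡ)
    where
      open ≤-Reasoning
      stepped : length (leftIdx v ++ Y) + suc (toℕ k′) ≤ m
      stepped = begin
        length (leftIdx v ++ Y) + suc (toℕ k′) ≤⟨ +-monoˡ-≤ _ (grow (leftIdx v) (leftIdx-short v) ≤-refl) ⟩
        suc (length Y) + suc (toℕ k′)          ≡⟨ sym (+-suc (length Y) (suc (toℕ k′))) ⟩
        length Y + suc (suc (toℕ k′))          ≡⟨ cong (λ p → length Y + suc p) (sym k≡) ⟩
        length Y + suc (toℕ k)                 ≤⟨ viable ⟩
        m                                      ∎
  ... | first-mid k≡0 =
    escapeTo (onLeft (leftIdx v ++ Y)) arrived
             (λ { (i , i∉ , refl) → mid i j k , (i , i∉ ∘ ∈-++⁺ʳ _ , refl) , inj₂ (inj₂ (lm k≡0)) })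
             (tabulate ∈-++⁺ˡ)
    where
      open ≤-Reasoning
      arrived : length (leftIdx v ++ Y) ≤ m
      arrived = begin
        length (leftIdx v ++ Y) ≤⟨ grow (leftIdx v) (leftIdx-short v) ≤-refl ⟩
        suc (length Y)          ≤⟨ s≤s (m≤m+n _ _) ⟩
        suc (length Y + toℕ k)  ≡⟨ sym (+-suc (length Y) (toℕ k)) ⟩
        length Y + suc (toℕ k)  ≤⟨ viable ⟩
        m                       ∎

  escape : ∀ c → Viable c → ∀ v → Escape Mem Viable c v
  escape (onRight _)       = atRight
  escape (onLeft _)        = atLeft
  escape (fromLeft _ _ _)  = runRight
  escape (fromRight _ _ _) = runLeft

  evasionSystem : EvasionSystem
  evasionSystem = record
    { Conf           = Conf
    ; Mem            = Mem
    ; Viable         = Viable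
    ; initial        = onRight []
    ; initial-viable = z≤n
    ; two-members    = two-members
    ; escape         = escape
    }

-- The main theorem: the robber evasion system on K_{a,b}^{1/m} defeats every
-- cop strategy.  (The hypotheses 3 ≤ a, 3 ≤ b follow from the others.)
mainTheorem5 : (a b m : ℕ) → 3 ≤ a → 3 ≤ b → 1 ≤ m → m + 2 ≤ a → m + 2 ≤ b →
               ¬ Locatable (SubK a b m)
mainTheorem5 a b m _ _ m≥1 a-large b-large =
  Evasion.evasion⇒¬locatable (SubK a b m) distanceBetween evasionSystem
  where open SubdividedBiclique a b m m≥1 a-large b-large
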